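{- For every integer $m\ge0$, the number of finite sets $S$ of nonnegative integers with $\sum_{k\in S}\phi^k=p_m$ equals the number of finite sets $T$ of integers $\ge2$ with $\sum_{k\in T}F_k=m$ (the Fibonacci diatomic sequence evaluated at $m$). In both counts the empty set counts as one representation of $0$.
   Context: Let $\phi=\frac{1+\sqrt5}{2}$, $\psi=1/\phi$, and let $F_1=F_2=1$, $F_{k+1}=F_k+F_{k-1}$ be the Fibonacci numbers. The Fibonacci words over $\{A,B\}$ are $w_1=A$, $w_2=AB$, $w_{n+2}=w_{n+1}w_n$; the infinite Fibonacci word $c_1c_2c_3\cdots=ABAABABAAB\cdots$ is their common extension. With $v(A)=1$, $v(B)=\psi$, set $p_0=0$ and $p_m=\sum_{i=1}^m v(c_i)$ for $m\ge1$ (the $m$-th phinary number). -}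

module Defs where

open import Data.Nat using (ℕ; zero; suc; _≤_; _<_)
import Data.Nat as ℕ
open import Data.Integer using (ℤ; +_; -[1+_])
import Data.Integer as ℤ
open import Data.List using (List; []; _∷_; _++_; take; map; foldr)
open import Data.List.Relation.Unary.Linked using (Linked)
open import Data.Product using (Σ; _×_; _,_)

F : ℕ → ℕ
F zero = 0
F (suc zero) = 1
F (suc (suc k)) = F (suc k) ℕ.+ F k

-- Elements of ℤ[φ]: the pair (a , b) denotes a + b·φ.
-- Since 1, φ are linearly independent over ℚ, equality of the
-- denoted real numbers is exactly equality of pairs.
Zφ : Set
Zφ = ℤ × ℤ

zero-φ : Zφ
zero-φ = (+ 0 , + 0)

_+φ_ : Zφ → Zφ → Zφ
(a , b) +φ (c , d) = (a ℤ.+ c , b ℤ.+ d)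

-- multiplication by φ, using φ² = φ + 1:  φ(a + bφ) = b + (a + b)φ
mulφ : Zφ → Zφ
mulφ (a , b) = (b , a ℤ.+ b)

φ^ : ℕ → Zφ
φ^ zero = (+ 1 , + 0)
φ^ (suc k) = mulφ (φ^ k)

-- ψ = 1/φ = φ - 1
ψ : Zφ
ψ = (-[1+ 0 ] , + 1)

-- Letters and Fibonacci words.  fibWord n is w_{n+1}:
-- w_1 = A, w_2 = AB, w_{n+2} = w_{n+1} w_n.
data Letter : Set where
  A B : Letter

fibWord : ℕ → List Letter
fibWord zero = A ∷ []
fibWord (suc zero) = A ∷ B ∷ []
fibWord (suc (suc n)) = fibWord (suc n) ++ fibWord n

v : Letter → Zφ
v A = (+ 1 , + 0)
v B = ψ

sumZφ : List Zφ → Zφ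
sumZφ = foldr _+φ_ zero-φ

-- p m = v(c_1) + ... + v(c_m); the first m letters of the infinite
-- Fibonacci word are the first m letters of w_{m+1} (of length F_{m+2} ≥ m).
p : ℕ → Zφ
p m = sumZφ (map v (take m (fibWord m)))

FinSetℕ : Set
FinSetℕ = Σ (List ℕ) (Linked _<_)

elems : FinSetℕ → List ℕ
elems (xs , _) = xs

φsum : FinSetℕ → Zφ
φsum S = sumZφ (map φ^ (elems S))

Fsum : FinSetℕ → ℕ
Fsum T = foldr ℕ._+_ 0 (map F (elems T))

-- The bijection is S ↦ S + 2 (add 2 to every element), with inverse
-- T ↦ T − 2.  Both directions rest on facts about ℤ[φ] and the
-- Fibonacci words w_{n+1} = fibWord n, whose letter values sum to φⁿ.
--
-- • S ↦ S + 2 is well defined: the additive map L(a + bφ) = a + 2b sends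
--   φᵏ to F_{k+2} and every letter value (1 and ψ = φ − 1) to 1, so
--   L(p m) = m.  Applying L to Σ_{k∈S} φᵏ = p m gives Σ_{k∈S} F_{k+2} = m.
-- • T ↦ T − 2 is well defined by the shift lemma
--       p (F_{k+2} + r) = φᵏ + p r      whenever r + 2 ≤ F_{k+3},
--   which holds because w_{k+3} = w_{k+1} (w_k w_{k+1}) and w_k w_{k+1}
--   agrees with w_{k+2} = w_{k+1} w_k except for its last two letters.
--   Peeling off the elements of T from the smallest upwards, the shift
--   lemma applies at every step, so p (Σ_{k∈T} F_k) = Σ_{k∈T} φ^{k−2}.
-- • Finite sets are strictly increasing lists whose ordering proofs are
--   propositions, so the two maps are mutually inverse.
module Submission where

open import Defs
open import Data.Nat using (ℕ; zero; suc; _≤_; _<_; z≤n; s≤s; _∸_; _≤′_; ≤′-refl; ≤′-step)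
import Data.Nat as ℕ
import Data.Nat.Properties as ℕP
open import Data.Integer using (ℤ; +_)
import Data.Integer as ℤ
import Data.Integer.Properties as ℤP
open import Data.Integer.Tactic.RingSolver using (solve-∀)
import Data.Nat.Tactic.RingSolver as ℕSolver
open import Data.List using (List; []; _∷_; _++_; take; map; foldr; length)
import Data.List.Properties as LP
open import Data.List.Relation.Unary.All using (All; []; _∷_)
import Data.List.Relation.Unary.All as All
open import Data.List.Relation.Unary.AllPairs using (AllPairs; []; _∷_)
open import Data.List.Relation.Unary.Linked using (Linked; []; [-]; _∷_)
import Data.List.Relation.Unary.Linked as Linked
open import Data.List.Relation.Unary.Linked.Properties using (Linked⇒AllPairs; map⁺)
open import Data.Product using (Σ; _×_; _,_)
import Data.Product.Properties as ×P
open import Data.Sum using (inj₁; inj₂)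
open import Relation.Binary.PropositionalEquality
open import Axiom.UniquenessOfIdentityProofs using (module Decidable⇒UIP)
open import Function.Bundles using (_↔_; mk↔ₛ′)

+φ-assoc : ∀ x y z → (x +φ y) +φ z ≡ x +φ (y +φ z)
+φ-assoc (a , b) (c , d) (e , f) = cong₂ _,_ (ℤP.+-assoc a c e) (ℤP.+-assoc b d f)

+φ-comm : ∀ x y → x +φ y ≡ y +φ x
+φ-comm (a , b) (c , d) = cong₂ _,_ (ℤP.+-comm a c) (ℤP.+-comm b d)

+φ-identityˡ : ∀ x → zero-φ +φ x ≡ x
+φ-identityˡ (a , b) = cong₂ _,_ (ℤP.+-identityˡ a) (ℤP.+-identityˡ b)

+φ-identityʳ : ∀ x → x +φ zero-φ ≡ x
+φ-identityʳ (a , b) = cong₂ _,_ (ℤP.+-identityʳ a) (ℤP.+-identityʳ b)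

sumZφ-++ : ∀ xs ys → sumZφ (xs ++ ys) ≡ sumZφ xs +φ sumZφ ys
sumZφ-++ [] ys = sym (+φ-identityˡ _)
sumZφ-++ (x ∷ xs) ys = trans (cong (x +φ_) (sumZφ-++ xs ys)) (sym (+φ-assoc x _ _))

φ^-rec : ∀ k → φ^ (suc (suc k)) ≡ φ^ (suc k) +φ φ^ k
φ^-rec k with φ^ k
... | (a , b) = cong₂ _,_ (ℤP.+-comm a b) (ℤP.+-comm b (a ℤ.+ b))

F-step : ∀ n → F n ≤ F (suc n)
F-step zero = z≤n
F-step (suc zero) = ℕP.≤-refl
F-step (suc (suc n)) = ℕP.m≤m+n _ _

F-mono : ∀ {m n} → m ≤ n → F m ≤ F n
F-mono m≤n = go (ℕP.≤⇒≤′ m≤n)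
  where
  go : ∀ {m n} → m ≤′ n → F m ≤ F n
  go ≤′-refl = ℕP.≤-refl
  go (≤′-step {n} m≤′n) = ℕP.≤-trans (go m≤′n) (F-step n)

m≤F[2+m] : ∀ m → m ≤ F (2 ℕ.+ m)
m≤F[2+m] zero = z≤n
m≤F[2+m] (suc m) = begin
  suc m                        ≤⟨ s≤s (m≤F[2+m] m) ⟩
  suc (F (2 ℕ.+ m))            ≡⟨ ℕP.+-comm 1 _ ⟩
  F (2 ℕ.+ m) ℕ.+ 1            ≤⟨ ℕP.+-monoʳ-≤ (F (2 ℕ.+ m)) (F-mono {1} {suc m} (s≤s z≤n)) ⟩
  F (2 ℕ.+ m) ℕ.+ F (suc m)    ∎
  where open ℕP.≤-Reasoning

val : List Letter → Zφ
val w = sumZφ (map v w)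

val-++ : ∀ u w → val (u ++ w) ≡ val u +φ val w
val-++ u w = trans (cong sumZφ (LP.map-++ v u w)) (sumZφ-++ (map v u) (map v w))

val-fibWord : ∀ n → val (fibWord n) ≡ φ^ n
val-fibWord zero = refl
val-fibWord (suc zero) = refl
val-fibWord (suc (suc n)) = begin
  val (fibWord (suc n) ++ fibWord n)       ≡⟨ val-++ (fibWord (suc n)) (fibWord n) ⟩
  val (fibWord (suc n)) +φ val (fibWord n) ≡⟨ cong₂ _+φ_ (val-fibWord (suc n)) (val-fibWord n) ⟩
  φ^ (suc n) +φ φ^ n                       ≡⟨ sym (φ^-rec n) ⟩
  φ^ (suc (suc n))                         ∎
  where open ≡-Reasoning

length-fibWord : ∀ n → length (fibWord n) ≡ F (2 ℕ.+ n)
length-fibWord zero = refl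
length-fibWord (suc zero) = refl
length-fibWord (suc (suc n)) = trans (LP.length-++ (fibWord (suc n)))
  (cong₂ ℕ._+_ (length-fibWord (suc n)) (length-fibWord n))

take-++-short : ∀ {X : Set} r (u w : List X) → r ≤ length u → take r (u ++ w) ≡ take r u
take-++-short zero u w _ = refl
take-++-short (suc r) (x ∷ u) w (s≤s r≤u) = cong (x ∷_) (take-++-short r u w r≤u)

take-++-long : ∀ {X : Set} r (u w : List X) → take (length u ℕ.+ r) (u ++ w) ≡ u ++ take r w
take-++-long r [] w = refl
take-++-long r (x ∷ u) w = cong (x ∷_) (take-++-long r u w)

fibWord-prefix : ∀ {a b} → a ≤ b → Σ (List Letter) λ t → fibWord b ≡ fibWord a ++ t
fibWord-prefix a≤b = go (ℕP.≤⇒≤′ a≤b)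
  where
  prefix-suc : ∀ n → Σ (List Letter) λ t → fibWord (suc n) ≡ fibWord n ++ t
  prefix-suc zero = B ∷ [] , refl
  prefix-suc (suc n) = fibWord n , refl
  go : ∀ {a b} → a ≤′ b → Σ (List Letter) λ t → fibWord b ≡ fibWord a ++ t
  go {a} ≤′-refl = [] , sym (LP.++-identityʳ (fibWord a))
  go {a} (≤′-step {n} a≤′n) with go a≤′n | prefix-suc n
  ... | t , eq | t′ , eq′ =
    t ++ t′ , trans eq′ (trans (cong (_++ t′) eq) (LP.++-assoc (fibWord a) t t′))

take-fibWord : ∀ m {a b} → a ≤ b → m ≤ length (fibWord a) → take m (fibWord b) ≡ take m (fibWord a)
take-fibWord m {a} a≤b m≤len with fibWord-prefix a≤b
... | t , eq = trans (cong (take m) eq) (take-++-short m (fibWord a) t m≤len)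

p-fromWord : ∀ m N → m ≤ length (fibWord N) → p m ≡ val (take m (fibWord N))
p-fromWord m N m≤len with ℕP.≤-total m N
... | inj₁ m≤N = cong val (sym (take-fibWord m m≤N m≤len[m]))
  where
  m≤len[m] : m ≤ length (fibWord m)
  m≤len[m] = ℕP.≤-trans (m≤F[2+m] m) (ℕP.≤-reflexive (sym (length-fibWord m)))
... | inj₂ N≤m = cong val (take-fibWord m N≤m m≤len)

almostCommute : ∀ j → Σ (List Letter) λ u → Σ Letter λ x → Σ Letter λ y →
  (fibWord j ++ fibWord (suc j) ≡ u ++ x ∷ y ∷ [])
  × (fibWord (suc j) ++ fibWord j ≡ u ++ y ∷ x ∷ [])
almostCommute zero = A ∷ [] , A , B , refl , refl
almostCommute (suc j) with almostCommute j
... | u , x , y , eq , eq′ =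
  fibWord (suc j) ++ u , y , x ,
  trans (cong (fibWord (suc j) ++_) eq′) (sym (LP.++-assoc (fibWord (suc j)) u _)) ,
  trans (LP.++-assoc (fibWord (suc j)) (fibWord j) (fibWord (suc j)))
    (trans (cong (fibWord (suc j) ++_) eq) (sym (LP.++-assoc (fibWord (suc j)) u _)))

take-almostCommute : ∀ j r → r ℕ.+ 2 ≤ F (4 ℕ.+ j) →
  take r (fibWord j ++ fibWord (suc j)) ≡ take r (fibWord (2 ℕ.+ j))
take-almostCommute j r bound with almostCommute j
... | u , x , y , eq , eq′ = begin
  take r (fibWord j ++ fibWord (suc j)) ≡⟨ cong (take r) eq ⟩
  take r (u ++ x ∷ y ∷ [])              ≡⟨ take-++-short r u _ r≤u ⟩
  take r u                              ≡⟨ sym (take-++-short r u _ r≤u) ⟩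
  take r (u ++ y ∷ x ∷ [])              ≡⟨ cong (take r) (sym eq′) ⟩
  take r (fibWord (2 ℕ.+ j))            ∎
  where
  open ≡-Reasoning
  length-u : length u ℕ.+ 2 ≡ F (4 ℕ.+ j)
  length-u = begin
    length u ℕ.+ 2                          ≡⟨ sym (LP.length-++ u) ⟩
    length (u ++ x ∷ y ∷ [])                ≡⟨ cong length (sym eq) ⟩
    length (fibWord j ++ fibWord (suc j))   ≡⟨ LP.length-++ (fibWord j) ⟩
    length (fibWord j) ℕ.+ length (fibWord (suc j))
      ≡⟨ cong₂ ℕ._+_ (length-fibWord j) (length-fibWord (suc j)) ⟩
    F (2 ℕ.+ j) ℕ.+ F (3 ℕ.+ j)             ≡⟨ ℕP.+-comm (F (2 ℕ.+ j)) _ ⟩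
    F (4 ℕ.+ j)                             ∎
  r≤u : r ≤ length u
  r≤u = ℕP.+-cancelʳ-≤ 2 r (length u) (ℕP.≤-trans bound (ℕP.≤-reflexive (sym length-u)))

p-shift : ∀ k r → r ℕ.+ 2 ≤ F (3 ℕ.+ k) → p (F (2 ℕ.+ k) ℕ.+ r) ≡ φ^ k +φ p r
p-shift zero r bound with ℕP.n≤0⇒n≡0 (ℕP.+-cancelʳ-≤ 2 r 0 bound)
... | refl = refl
p-shift (suc j) r bound = begin
  p (F (3 ℕ.+ j) ℕ.+ r)
    ≡⟨ p-fromWord _ (3 ℕ.+ j) fits ⟩
  val (take (F (3 ℕ.+ j) ℕ.+ r) (fibWord (3 ℕ.+ j)))
    ≡⟨ cong (λ n → val (take (n ℕ.+ r) (fibWord (3 ℕ.+ j)))) (sym (length-fibWord (suc j))) ⟩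
  val (take (length (fibWord (suc j)) ℕ.+ r) ((fibWord (suc j) ++ fibWord j) ++ fibWord (suc j)))
    ≡⟨ cong (λ w → val (take (length (fibWord (suc j)) ℕ.+ r) w))
            (LP.++-assoc (fibWord (suc j)) (fibWord j) (fibWord (suc j))) ⟩
  val (take (length (fibWord (suc j)) ℕ.+ r) (fibWord (suc j) ++ (fibWord j ++ fibWord (suc j))))
    ≡⟨ cong val (take-++-long r (fibWord (suc j)) _) ⟩
  val (fibWord (suc j) ++ take r (fibWord j ++ fibWord (suc j)))
    ≡⟨ val-++ (fibWord (suc j)) _ ⟩
  val (fibWord (suc j)) +φ val (take r (fibWord j ++ fibWord (suc j)))
    ≡⟨ cong₂ _+φ_ (val-fibWord (suc j)) (cong val (take-almostCommute j r bound)) ⟩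
  φ^ (suc j) +φ val (take r (fibWord (2 ℕ.+ j)))
    ≡⟨ cong (φ^ (suc j) +φ_) (sym (p-fromWord r (2 ℕ.+ j) r≤len)) ⟩
  φ^ (suc j) +φ p r
    ∎
  where
  open ≡-Reasoning
  r≤len : r ≤ length (fibWord (2 ℕ.+ j))
  r≤len = ℕP.≤-trans (ℕP.≤-trans (ℕP.m≤m+n r 2) bound)
                     (ℕP.≤-reflexive (sym (length-fibWord (2 ℕ.+ j))))
  fits : F (3 ℕ.+ j) ℕ.+ r ≤ length (fibWord (3 ℕ.+ j))
  fits = ℕP.≤-trans (ℕP.+-monoʳ-≤ (F (3 ℕ.+ j)) (ℕP.≤-trans (ℕP.m≤m+n r 2) bound))
           (ℕP.≤-reflexive (trans (ℕP.+-comm (F (3 ℕ.+ j)) _) (sym (length-fibWord (3 ℕ.+ j)))))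

Fs : List ℕ → ℕ
Fs xs = foldr ℕ._+_ 0 (map F xs)

φs : List ℕ → Zφ
φs xs = sumZφ (map φ^ xs)

-- If x < y and r + 2 ≤ F_{x+1}, then after absorbing F_x the remainder
-- F_x + r still satisfies the side condition of the shift lemma at y.
shift-room : ∀ {x y} r → x < y → r ℕ.+ 2 ≤ F (suc x) → (F x ℕ.+ r) ℕ.+ 2 ≤ F (suc y)
shift-room {x} {y} r x<y bound = begin
  (F x ℕ.+ r) ℕ.+ 2   ≡⟨ ℕP.+-assoc (F x) r 2 ⟩
  F x ℕ.+ (r ℕ.+ 2)   ≤⟨ ℕP.+-monoʳ-≤ (F x) bound ⟩
  F x ℕ.+ F (suc x)   ≡⟨ ℕP.+-comm (F x) _ ⟩
  F (suc (suc x))     ≤⟨ F-mono (s≤s x<y) ⟩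
  F (suc y)           ∎
  where open ℕP.≤-Reasoning

p-Fs : ∀ r {ys} → AllPairs _<_ ys → All (2 ≤_) ys → All (λ x → r ℕ.+ 2 ≤ F (suc x)) ys →
  p (Fs ys ℕ.+ r) ≡ φs (map (_∸ 2) ys) +φ p r
p-Fs r [] [] [] = sym (+φ-identityˡ (p r))
p-Fs r {suc (suc k) ∷ xs} (x<xs ∷ increasing) (s≤s (s≤s z≤n) ∷ xs≥2) (room ∷ _) = begin
  p ((F (2 ℕ.+ k) ℕ.+ Fs xs) ℕ.+ r)
    ≡⟨ cong p (regroup (F (2 ℕ.+ k)) (Fs xs) r) ⟩
  p (Fs xs ℕ.+ (F (2 ℕ.+ k) ℕ.+ r))
    ≡⟨ p-Fs (F (2 ℕ.+ k) ℕ.+ r) increasing xs≥2 (All.map (λ x<y → shift-room r x<y room) x<xs) ⟩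
  φs xs′ +φ p (F (2 ℕ.+ k) ℕ.+ r)
    ≡⟨ cong (φs xs′ +φ_) (p-shift k r room) ⟩
  φs xs′ +φ (φ^ k +φ p r)
    ≡⟨ sym (+φ-assoc (φs xs′) (φ^ k) (p r)) ⟩
  (φs xs′ +φ φ^ k) +φ p r
    ≡⟨ cong (_+φ p r) (+φ-comm (φs xs′) (φ^ k)) ⟩
  (φ^ k +φ φs xs′) +φ p r
    ∎
  where
  open ≡-Reasoning
  xs′ : List ℕ
  xs′ = map (_∸ 2) xs
  regroup : ∀ a b c → (a ℕ.+ b) ℕ.+ c ≡ b ℕ.+ (a ℕ.+ c)
  regroup = ℕSolver.solve-∀

φs-down : ∀ {ys} → Linked _<_ ys → All (2 ≤_) ys → φs (map (_∸ 2) ys) ≡ p (Fs ys)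
φs-down {ys} increasing ys≥2 = begin
  φs (map (_∸ 2) ys)           ≡⟨ sym (+φ-identityʳ _) ⟩
  φs (map (_∸ 2) ys) +φ p 0    ≡⟨ sym (p-Fs 0 (Linked⇒AllPairs ℕP.<-trans increasing) ys≥2 room) ⟩
  p (Fs ys ℕ.+ 0)              ≡⟨ cong p (ℕP.+-identityʳ (Fs ys)) ⟩
  p (Fs ys)                    ∎
  where
  open ≡-Reasoning
  room : All (λ x → 2 ≤ F (suc x)) ys
  room = All.map (λ x≥2 → F-mono {3} (s≤s x≥2)) ys≥2

L : Zφ → ℤ
L (a , b) = a ℤ.+ (b ℤ.+ b)

L-+φ : ∀ x y → L (x +φ y) ≡ L x ℤ.+ L y
L-+φ (a , b) (c , d) = rearrange a b c d
  where
  rearrange : ∀ a b c d → (a ℤ.+ c) ℤ.+ ((b ℤ.+ d) ℤ.+ (b ℤ.+ d)) ≡ (a ℤ.+ (b ℤ.+ b)) ℤ.+ (c ℤ.+ (d ℤ.+ d))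
  rearrange = solve-∀

L-φ^ : ∀ k → L (φ^ k) ≡ + F (2 ℕ.+ k)
L-φ^ zero = refl
L-φ^ (suc zero) = refl
L-φ^ (suc (suc k)) = begin
  L (φ^ (suc (suc k)))                 ≡⟨ cong L (φ^-rec k) ⟩
  L (φ^ (suc k) +φ φ^ k)               ≡⟨ L-+φ (φ^ (suc k)) (φ^ k) ⟩
  L (φ^ (suc k)) ℤ.+ L (φ^ k)          ≡⟨ cong₂ ℤ._+_ (L-φ^ (suc k)) (L-φ^ k) ⟩
  + F (3 ℕ.+ k) ℤ.+ + F (2 ℕ.+ k)      ∎
  where open ≡-Reasoning

-- Every letter has L-value 1, so L measures the length of a word.
L-val : ∀ w → L (val w) ≡ + length w
L-val [] = refl
L-val (c ∷ w) = trans (L-+φ (v c) (val w)) (cong₂ ℤ._+_ (L-v c) (L-val w))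
  where
  L-v : ∀ c → L (v c) ≡ + 1
  L-v A = refl
  L-v B = refl

L-p : ∀ m → L (p m) ≡ + m
L-p m = trans (L-val (take m (fibWord m)))
  (cong +_ (trans (LP.length-take m (fibWord m)) (ℕP.m≤n⇒m⊓n≡m m≤len)))
  where
  m≤len : m ≤ length (fibWord m)
  m≤len = ℕP.≤-trans (m≤F[2+m] m) (ℕP.≤-reflexive (sym (length-fibWord m)))

L-φs : ∀ xs → L (φs xs) ≡ + Fs (map (2 ℕ.+_) xs)
L-φs [] = refl
L-φs (x ∷ xs) = trans (L-+φ (φ^ x) (φs xs)) (cong₂ ℤ._+_ (L-φ^ x) (L-φs xs))

Fs-up : ∀ m xs → φs xs ≡ p m → Fs (map (2 ℕ.+_) xs) ≡ m
Fs-up m xs eq = ℤP.+-injective (trans (sym (L-φs xs)) (trans (cong L eq) (L-p m)))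

increasing-up : ∀ {xs} → Linked _<_ xs → Linked _<_ (map (2 ℕ.+_) xs)
increasing-up increasing = map⁺ (Linked.map (λ x<y → s≤s (s≤s x<y)) increasing)

increasing-down : ∀ {xs} → All (2 ≤_) xs → Linked _<_ xs → Linked _<_ (map (_∸ 2) xs)
increasing-down _ [] = []
increasing-down _ [-] = [-]
increasing-down (x≥2 ∷ xs≥2) (x<y ∷ l) = ℕP.∸-monoˡ-< x<y x≥2 ∷ increasing-down xs≥2 l

all-up≥2 : ∀ xs → All (2 ≤_) (map (2 ℕ.+_) xs)
all-up≥2 [] = []
all-up≥2 (x ∷ xs) = s≤s (s≤s z≤n) ∷ all-up≥2 xs

elems-down∘up : ∀ xs → map (_∸ 2) (map (2 ℕ.+_) xs) ≡ xs
elems-down∘up [] = refl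
elems-down∘up (x ∷ xs) = cong (x ∷_) (elems-down∘up xs)

elems-up∘down : ∀ xs → All (2 ≤_) xs → map (2 ℕ.+_) (map (_∸ 2) xs) ≡ xs
elems-up∘down [] _ = refl
elems-up∘down (x ∷ xs) (x≥2 ∷ xs≥2) = cong₂ _∷_ (ℕP.m+[n∸m]≡n x≥2) (elems-up∘down xs xs≥2)

FinSet-≡ : ∀ {P : FinSetℕ → Set} → (∀ {S} (a b : P S) → a ≡ b) →
  ∀ {xs ys} {l : Linked _<_ xs} {l′ : Linked _<_ ys} {a : P (xs , l)} {b : P (ys , l′)} →
  xs ≡ ys → _≡_ {A = Σ FinSetℕ P} ((xs , l) , a) ((ys , l′) , b)
FinSet-≡ P-irrelevant {l = l} {l′} {a} {b} refl
  with Linked.irrelevant ℕP.<-irrelevant l l′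
... | refl = cong (_ ,_) (P-irrelevant a b)

Zφ-≡-irrelevant : ∀ {x y : Zφ} (e e′ : x ≡ y) → e ≡ e′
Zφ-≡-irrelevant = Decidable⇒UIP.≡-irrelevant (×P.≡-dec ℤP._≟_ ℤP._≟_)

mainTheorem12 : (m : ℕ) →
    (Σ FinSetℕ (λ S → φsum S ≡ p m))
      ↔ (Σ FinSetℕ (λ T → All (2 ≤_) (elems T) × Fsum T ≡ m))
mainTheorem12 m = mk↔ₛ′ up down up∘down down∘up
  where
  up : Σ FinSetℕ (λ S → φsum S ≡ p m) → Σ FinSetℕ (λ T → All (2 ≤_) (elems T) × Fsum T ≡ m)
  up ((xs , l) , eq) = (map (2 ℕ.+_) xs , increasing-up l) , all-up≥2 xs , Fs-up m xs eq
  down : Σ FinSetℕ (λ T → All (2 ≤_) (elems T) × Fsum T ≡ m) → Σ FinSetℕ (λ S → φsum S ≡ p m)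
  down ((ys , l) , ys≥2 , eq) = (map (_∸ 2) ys , increasing-down ys≥2 l) , trans (φs-down l ys≥2) (cong p eq)
  up∘down : ∀ T → up (down T) ≡ T
  up∘down ((ys , _) , ys≥2 , _) = FinSet-≡
    (λ (a , e) (a′ , e′) → cong₂ _,_ (All.irrelevant ℕP.≤-irrelevant a a′) (ℕP.≡-irrelevant e e′))
    (elems-up∘down ys ys≥2)
  down∘up : ∀ S → down (up S) ≡ S
  down∘up ((xs , _) , _) = FinSet-≡ Zφ-≡-irrelevant (elems-down∘up xs)
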